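{- Let $\mathcal{T}$ be a complete context tree over $A$. Then its perfect-memory closure is the union at the root of all subtrees of $\mathcal{T}$ rooted at nodes of $\mathcal{T}$: $$\overline{\mathcal{T}}=\bigcup_{\mathcal{S}\in\mathcal{T}_\star}\mathcal{S}.$$
   Context: Fix a finite alphabet $A=\{a_1,\dots,a_n\}$. Strings are finite sequences (possibly empty) of letters of $A$; $\overline{uv}$ is concatenation; $v\prec s$ ($v$ is a postfix of $s$) if $s=\overline{wv}$ for some string $w$. A context tree over $A$ is a finite rooted tree whose non-root vertices are labeled by letters of $A$, no two siblings having the same label; a context is the string read along the path from a leaf to the root (leaf's label first, label of the root's child last), and $\mathcal{T}^*$ is the set of contexts. $\mathcal{T}$ is complete if every node is a leaf or has exactly $n$ children. $\mathcal{A}\subseteq\mathcal{B}$ ("contained at the root") means every $a\in\mathcal{A}^*$ satisfies $a\prec b$ for some $b\in\mathcal{B}^*$. $\mathcal{T}$ has perfect memory if for every $c\in\mathcal{T}^*$ and every $i$ there exists $u\in\mathcal{T}^*$ with $u\prec\overline{ca_i}$. The perfect-memory closure $\overline{\mathcal{T}}$ is the smallest (with respect to $\subseteq$) perfect-memory context tree containing $\mathcal{T}$ (equivalently, the intersection at the root of all perfect-memory context trees containing $\mathcal{T}$). For complete $\mathcal{A},\mathcal{B}$, the union at the root $\mathcal{A}\cup\mathcal{B}$ is the context tree with contexts $\{u\in\mathcal{A}^*:\exists c\in\mathcal{B}^*, c\prec u\}\cup\{u\in\mathcal{B}^*:\exists c\in\mathcal{A}^*, c\prec u\}$; the union at the root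 of a finite family is obtained by iterating this. $\mathcal{T}_\star$ is the set of all subtrees of $\mathcal{T}$ whose root is a node of $\mathcal{T}$ (including $\mathcal{T}$ itself), each viewed as a context tree: for the node reached from the root by the path labeled $a_{i_1},a_{i_2},\dots,a_{i_k}$ (so $s=\overline{a_{i_k}\cdots a_{i_1}}$), the subtree $((\mathcal{T}_{i_1})_{i_2})\cdots$ has contexts $\{u \text{ nonempty}: \overline{us}\in\mathcal{T}^*\}$. -}

module Defs where

open import Data.Nat using (ℕ)
open import Data.Fin using (Fin)
open import Data.List using (List; []; _∷_; _++_; reverse; [_]; allFin)
open import Data.Maybe using (Maybe; just; nothing)
open import Data.Product using (Σ; ∃; _×_; _,_)
open import Data.Sum using (_⊎_)
open import Data.Empty using (⊥)
open import Relation.Binary.PropositionalEquality using (_≡_)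
open import Function.Bundles using (_⇔_)

-- Alphabet A = Fin n (letter a_i is i). Strings are lists of letters.
Str : ℕ → Set
Str n = List (Fin n)

_≺_ : ∀ {n} → Str n → Str n → Set
v ≺ s = ∃ λ w → s ≡ w ++ v

-- A context tree over Fin n: a finite rooted tree; each node has, for each
-- letter i, at most one child labelled i (siblings have distinct labels).
data Tree (n : ℕ) : Set where
  node : (Fin n → Maybe (Tree n)) → Tree n

-- LeafPath t p : p is the list of labels read from the root down to a leaf
-- of t (root's child label first).
data LeafPath {n : ℕ} : Tree n → List (Fin n) → Set where
  leaf : ∀ {f} → (∀ i → f i ≡ nothing) → LeafPath (node f) []
  step : ∀ {f t p} i → f i ≡ just t → LeafPath t p → LeafPath (node f) (i ∷ p)

-- Contexts: strings read from a leaf to the root (leaf's label first).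
_∈ctx_ : ∀ {n} → Str n → Tree n → Set
c ∈ctx t = LeafPath t (reverse c)

data Complete {n : ℕ} : Tree n → Set where
  leafC : ∀ {f} → (∀ i → f i ≡ nothing) → Complete (node f)
  nodeC : ∀ {f} (g : Fin n → Tree n) → (∀ i → f i ≡ just (g i))
        → (∀ i → Complete (g i)) → Complete (node f)

_⊆ʳ_ : ∀ {n} → Tree n → Tree n → Set
A ⊆ʳ B = ∀ a → a ∈ctx A → ∃ λ b → b ∈ctx B × a ≺ b

PerfectMemory : ∀ {n} → Tree n → Set
PerfectMemory {n} T = ∀ c → c ∈ctx T → (i : Fin n) →
  ∃ λ u → u ∈ctx T × u ≺ (c ++ [ i ])

IsClosure : ∀ {n} → Tree n → Tree n → Set
IsClosure {n} T C = PerfectMemory C × T ⊆ʳ C ×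
  ((P : Tree n) → PerfectMemory P → T ⊆ʳ P → C ⊆ʳ P)

IsUnion : ∀ {n} → Tree n → Tree n → Tree n → Set
IsUnion A B U = ∀ u → u ∈ctx U ⇔
  ((u ∈ctx A × ∃ λ c → c ∈ctx B × c ≺ u) ⊎ (u ∈ctx B × ∃ λ c → c ∈ctx A × c ≺ u))

data UnionOf {n : ℕ} : List (Tree n) → Tree n → Set where
  single : ∀ S → UnionOf (S ∷ []) S
  cons   : ∀ {S Ss V U} → UnionOf Ss V → IsUnion S V U → UnionOf (S ∷ Ss) U

mutual
  subtrees : ∀ {n} → Tree n → List (Tree n)
  subtrees {n} (node f) = node f ∷ subsAt f (allFin n)

  subsAt : ∀ {n} → (Fin n → Maybe (Tree n)) → List (Fin n) → List (Tree n)
  subsAt f [] = []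
  subsAt f (i ∷ is) = subsM (f i) ++ subsAt f is

  subsM : ∀ {n} → Maybe (Tree n) → List (Tree n)
  subsM nothing = []
  subsM (just t) = subtrees t

-- The contexts of the union of the subtrees are the strings u that are contexts
-- of some subtree and have a postfix among the contexts of every subtree.  This
-- set is closed under appending a letter i: by completeness each subtree
-- either has a context that is a postfix of u i or a context z u i, and in the
-- latter case z u is a context of another subtree, which forces z = [] because
-- that subtree also has a context which is a postfix of u.  Every context of T
-- extends to such a string, again by completeness.  Conversely, if P has perfect
-- memory and contains T, a context u of a subtree is an infix of a context b of
-- P, and reading u through P from b ends at a context of P that extends u.
-- The union exists because two complete trees can be merged node by node.

module Submission where

open import Defs
open import Data.Nat using (ℕ; zero; suc)
open import Data.Fin as Fin using (Fin)
open import Data.List using (List; []; _∷_; _++_; reverse; [_]; allFin)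
open import Data.List.Properties
  using (reverse-++; reverse-involutive; reverse-injective; ++-assoc; ++-identityʳ;
         ++-identityˡ-unique; ++-conicalˡ; ++-conicalʳ; ++-cancelʳ; ∷-injective)
open import Data.List.Relation.Unary.Any using (Any; here; there)
open import Data.List.Relation.Unary.All as All using (All; []; _∷_)
open import Data.List.Membership.Propositional using (_∈_; find; lose)
open import Data.List.Membership.Propositional.Properties using (∈-++⁻; ∈-++⁺ˡ; ∈-++⁺ʳ; ∈-allFin)
open import Data.Maybe using (Maybe; just; nothing)
open import Data.Maybe.Properties using (just-injective)
open import Data.Product using (∃; _×_; _,_; proj₁; proj₂)
open import Data.Sum using (_⊎_; inj₁; inj₂; swap; map₂)
open import Data.Sum.Function.Propositional using (_⊎-⇔_)
open import Data.Empty using (⊥-elim)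
open import Relation.Nullary using (¬_)
open import Relation.Binary.PropositionalEquality
  using (_≡_; _≢_; refl; sym; trans; cong; subst; module ≡-Reasoning)
open import Function.Bundles using (_⇔_; mk⇔; Equivalence)
open import Function.Properties.Equivalence using () renaming (trans to ⇔-trans)

open Equivalence using (to; from)

private variable
  n : ℕ
  a b c s u w x y z p q : Str n
  A B S T U P : Tree n
  Ss : List (Tree n)
  f : Fin n → Maybe (Tree n)
  i : Fin n

just≢nothing : ∀ {t : Tree n} → just t ≢ nothing
just≢nothing ()

≺-refl : (a : Str n) → a ≺ a
≺-refl a = [] , refl

≺-trans : a ≺ b → b ≺ c → a ≺ c
≺-trans {a = a} (x , refl) (y , refl) = y ++ x , sym (++-assoc y x a)

≺-++ʳ : ∀ w → a ≺ b → (a ++ w) ≺ (b ++ w)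
≺-++ʳ {a = a} w (x , refl) = x , ++-assoc x a w

≺-cancelʳ : ∀ w → (a ++ w) ≺ (b ++ w) → a ≺ b
≺-cancelʳ {a = a} {b} w (x , e) = x , ++-cancelʳ w b (x ++ a) (trans e (sym (++-assoc x a w)))

x++a≺a⇒x≡[] : ∀ x → (x ++ a) ≺ a → x ≡ []
x++a≺a⇒x≡[] {a = a} x (y , e) =
  ++-conicalʳ y x (++-identityˡ-unique (y ++ x) (trans e (sym (++-assoc y x a))))

++-split : ∀ x y → x ++ a ≡ y ++ b → b ≺ a ⊎ a ≺ b
++-split []      y       e = inj₁ (y , e)
++-split (d ∷ x) []      e = inj₂ (d ∷ x , sym e)
++-split (d ∷ x) (_ ∷ y) e = ++-split x y (proj₂ (∷-injective e))

≺-comparable : a ≺ w → b ≺ w → a ≺ b ⊎ b ≺ a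
≺-comparable (x , e₁) (y , e₂) = swap (++-split x y (trans (sym e₁) e₂))

-- Leaf paths are read from the root, so postfixes of contexts are prefixes of paths.
_⊑_ : Str n → Str n → Set
p ⊑ q = ∃ λ r → q ≡ p ++ r

≺⇒reverse-⊑ : a ≺ b → reverse a ⊑ reverse b
≺⇒reverse-⊑ {a = a} (x , refl) = reverse x , reverse-++ x a

⊑-reverse⇒≺ : p ⊑ reverse u → reverse p ≺ u
⊑-reverse⇒≺ {p = p} {u} (r , e) =
  reverse r , (begin
    u                           ≡⟨ reverse-involutive u ⟨
    reverse (reverse u)         ≡⟨ cong reverse e ⟩
    reverse (p ++ r)            ≡⟨ reverse-++ p r ⟩
    reverse r ++ reverse p      ∎)
  where open ≡-Reasoning

reverse-⊑⇒≺ : reverse u ⊑ p → u ≺ reverse p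
reverse-⊑⇒≺ {u = u} {p} (r , refl) =
  reverse r , trans (reverse-++ (reverse u) r) (cong (reverse r ++_) (reverse-involutive u))

leafPath⇒∈ctx : LeafPath T p → reverse p ∈ctx T
leafPath⇒∈ctx {T = T} = subst (LeafPath T) (sym (reverse-involutive _))

leafPath-∷ : f i ≡ just T → LeafPath (node f) (i ∷ p) ⇔ LeafPath T p
leafPath-∷ e = mk⇔ (λ { (step _ e′ lp) → subst (λ t → LeafPath t _) (just-injective (trans (sym e′) e)) lp })
                   (step _ e)

leafPath-[] : {g : Fin n → Tree n} → (∀ i → f i ≡ just (g i)) → LeafPath (node f) [] ⇔ (¬ Fin n)
leafPath-[] e = mk⇔ (λ { (leaf h) i → just≢nothing (trans (sym (e i)) (h i)) })
                    (λ ¬i → leaf (λ i → ⊥-elim (¬i i)))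

leafPath-prefix : LeafPath T p → LeafPath T (p ++ q) → q ≡ []
leafPath-prefix {q = []}    _          _             = refl
leafPath-prefix {q = _ ∷ _} (leaf h)   (step _ e _)  = ⊥-elim (just≢nothing (trans (sym e) (h _)))
leafPath-prefix (step _ e lp) lp′ = leafPath-prefix lp (to (leafPath-∷ e) lp′)

∈ctx-≺⇒≡ : a ∈ctx T → b ∈ctx T → a ≺ b → a ≡ b
∈ctx-≺⇒≡ {a = a} {T = T} ha hb (z , refl) = cong (_++ a) (sym z≡[])
  where
  z≡[] : z ≡ []
  z≡[] = reverse-injective (leafPath-prefix ha (subst (LeafPath T) (reverse-++ z a) hb))

Covers : Tree n → Str n → Set
Covers T u = ∃ λ c → c ∈ctx T × c ≺ u

complete-leafPath : ∀ {n} {T : Tree n} → Complete T → ∃ (LeafPath T)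
complete-leafPath (leafC h) = [] , leaf h
complete-leafPath {n = zero}  (nodeC _ _ _)  = [] , leaf (λ ())
complete-leafPath {n = suc _} (nodeC _ e cs) =
  let p , lp = complete-leafPath (cs Fin.zero) in Fin.zero ∷ p , step Fin.zero (e Fin.zero) lp

complete-dichotomy : Complete T → ∀ p →
  (∃ λ l → LeafPath T l × l ⊑ p) ⊎ (∃ λ l → LeafPath T l × p ⊑ l)
complete-dichotomy (leafC h) p = inj₁ ([] , leaf h , p , refl)
complete-dichotomy cT [] = let l , lp = complete-leafPath cT in inj₂ (l , lp , l , refl)
complete-dichotomy (nodeC _ e cs) (i ∷ p) with complete-dichotomy (cs i) p
... | inj₁ (l , lp , r , refl) = inj₁ (i ∷ l , step i (e i) lp , r , refl)
... | inj₂ (l , lp , r , refl) = inj₂ (i ∷ l , step i (e i) lp , r , refl)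

∈ctx-dichotomy : Complete T → ∀ u → Covers T u ⊎ ∃ λ c → c ∈ctx T × u ≺ c
∈ctx-dichotomy cT u with complete-dichotomy cT (reverse u)
... | inj₁ (l , lp , l⊑u) = inj₁ (reverse l , leafPath⇒∈ctx lp , ⊑-reverse⇒≺ l⊑u)
... | inj₂ (l , lp , u⊑l) = inj₂ (reverse l , leafPath⇒∈ctx lp , reverse-⊑⇒≺ u⊑l)

data SubtreeAt {n : ℕ} : Tree n → List (Fin n) → Tree n → Set where
  root  : SubtreeAt T [] T
  child : ∀ {t} → f i ≡ just t → SubtreeAt t q S → SubtreeAt (node f) (i ∷ q) S

SubtreeAt-complete : Complete T → SubtreeAt T q S → Complete S
SubtreeAt-complete cT             root         = cT
SubtreeAt-complete (leafC h)      (child e _)  = ⊥-elim (just≢nothing (trans (sym e) (h _)))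
SubtreeAt-complete (nodeC _ e cs) (child {i = i} e′ st) =
  SubtreeAt-complete (cs i) (subst (λ t → SubtreeAt t _ _) (just-injective (trans (sym e′) (e i))) st)

SubtreeAt-leafPath : SubtreeAt T q S → LeafPath S p → LeafPath T (q ++ p)
SubtreeAt-leafPath root         lp = lp
SubtreeAt-leafPath (child e st) lp = step _ e (SubtreeAt-leafPath st lp)

leafPath-SubtreeAt : ∀ q → LeafPath T (q ++ p) → ∃ λ S → SubtreeAt T q S × LeafPath S p
leafPath-SubtreeAt []      lp            = _ , root , lp
leafPath-SubtreeAt (i ∷ q) (step .i e lp) =
  let S , st , lp′ = leafPath-SubtreeAt q lp in S , child e st , lp′

∈-subsAt⁺ : ∀ f {is : List (Fin n)} → i ∈ is → S ∈ subsM (f i) → S ∈ subsAt f is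
∈-subsAt⁺ f {j ∷ _} (here refl) m = ∈-++⁺ˡ m
∈-subsAt⁺ f {j ∷ _} (there k)   m = ∈-++⁺ʳ (subsM (f j)) (∈-subsAt⁺ f k m)

∈-subtrees⁺ : SubtreeAt T q S → S ∈ subtrees T
∈-subtrees⁺ {T = node _} root = here refl
∈-subtrees⁺ (child {f = f} {i = i} e st) =
  there (∈-subsAt⁺ f (∈-allFin i) (subst (λ mt → _ ∈ subsM mt) (sym e) (∈-subtrees⁺ st)))

mutual
  ∈-subtrees⁻ : ∀ T → S ∈ subtrees T → ∃ λ q → SubtreeAt T q S
  ∈-subtrees⁻ (node f) (here refl) = [] , root
  ∈-subtrees⁻ (node f) (there m)   = ∈-subsAt⁻ f (allFin _) m

  ∈-subsAt⁻ : ∀ f (is : List (Fin n)) → S ∈ subsAt f is → ∃ λ q → SubtreeAt (node f) q S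
  ∈-subsAt⁻ f (i ∷ is) m with ∈-++⁻ (subsM (f i)) m
  ... | inj₁ m′ = ∈-subsM⁻ (f i) refl m′
  ... | inj₂ m′ = ∈-subsAt⁻ f is m′

  ∈-subsM⁻ : ∀ mt → f i ≡ mt → S ∈ subsM mt → ∃ λ q → SubtreeAt (node f) q S
  ∈-subsM⁻ (just t) e m = let q , st = ∈-subtrees⁻ t m in _ , child e st

subtrees-complete : Complete T → All Complete (subtrees T)
subtrees-complete {T = T} cT = All.tabulate (λ m → SubtreeAt-complete cT (proj₂ (∈-subtrees⁻ T m)))

∈ctx-subtree⁻ : S ∈ subtrees T → ∀ u → u ∈ctx S → ∃ λ s → (u ++ s) ∈ctx T
∈ctx-subtree⁻ {T = T} m u hu with ∈-subtrees⁻ T m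
... | q , st = reverse q , subst (LeafPath T) (sym reverse-u++s) (SubtreeAt-leafPath st hu)
  where
  reverse-u++s : reverse (u ++ reverse q) ≡ q ++ reverse u
  reverse-u++s = trans (reverse-++ u (reverse q)) (cong (_++ reverse u) (reverse-involutive q))

∈ctx-subtree⁺ : ∀ x y → (x ++ y) ∈ctx T → ∃ λ S → S ∈ subtrees T × x ∈ctx S
∈ctx-subtree⁺ x y h with leafPath-SubtreeAt (reverse y) (subst (LeafPath _) (reverse-++ x y) h)
... | S , st , lp = S , ∈-subtrees⁺ st , lp

LeafBelow : Tree n → Tree n → List (Fin n) → Set
LeafBelow A B p = LeafPath A p × ∃ λ q → LeafPath B q × q ⊑ p

PathUnion : Tree n → Tree n → Tree n → Set
PathUnion A B U = ∀ p → LeafPath U p ⇔ (LeafBelow A B p ⊎ LeafBelow B A p)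

PathUnion-sym : PathUnion A B U → PathUnion B A U
PathUnion-sym pu p = mk⇔ (λ lp → swap (to (pu p) lp)) (λ r → from (pu p) (swap r))

leaf-PathUnion : (∀ i → f i ≡ nothing) → PathUnion (node f) B B
leaf-PathUnion {B = B} h p = mk⇔ (λ lp → inj₂ (lp , [] , leaf h , p , refl)) λ where
  (inj₁ (leaf _ , q , lq , r , e)) → subst (LeafPath B) (++-conicalˡ q r (sym e)) lq
  (inj₁ (step i e _ , _))          → ⊥-elim (just≢nothing (trans (sym e) (h i)))
  (inj₂ (lp , _))                  → lp

module _ {fA fB : Fin n → Maybe (Tree n)} (eA : fA i ≡ just A) (eB : fB i ≡ just B) where

  LeafBelow-∷⁺ : LeafBelow A B p → LeafBelow (node fA) (node fB) (i ∷ p)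
  LeafBelow-∷⁺ (la , q , lb , r , e) = step _ eA la , _ ∷ q , step _ eB lb , r , cong (_ ∷_) e

  LeafBelow-∷⁻ : LeafBelow (node fA) (node fB) (i ∷ p) → LeafBelow A B p
  LeafBelow-∷⁻ (_  , []    , leaf h , _ , _)    = ⊥-elim (just≢nothing (trans (sym eB) (h _)))
  LeafBelow-∷⁻ (la , _ ∷ q , lb     , r , refl) = to (leafPath-∷ eA) la , q , to (leafPath-∷ eB) lb , r , refl

  LeafBelow-∷ : LeafBelow A B p ⇔ LeafBelow (node fA) (node fB) (i ∷ p)
  LeafBelow-∷ = mk⇔ LeafBelow-∷⁺ LeafBelow-∷⁻

PathUnion-exists : ∀ {n} {A B : Tree n} → Complete A → Complete B → ∃ λ U → Complete U × PathUnion A B U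
PathUnion-exists (leafC h) cB = _ , cB , leaf-PathUnion h
PathUnion-exists cA (leafC h) = _ , cA , PathUnion-sym (leaf-PathUnion h)
PathUnion-exists {n = n} {A = node fA} {B = node fB} (nodeC g eA csA) (nodeC k eB csB) =
  node (λ i → just (merged-child i)) , nodeC merged-child (λ _ → refl) (λ i → proj₁ (proj₂ (merged i))) , pathUnion
  where
  merged : ∀ i → ∃ λ U → Complete U × PathUnion (g i) (k i) U
  merged i = PathUnion-exists (csA i) (csB i)

  merged-child : Fin n → Tree n
  merged-child i = proj₁ (merged i)

  pathUnion : PathUnion (node fA) (node fB) (node (λ i → just (merged-child i)))
  pathUnion [] = mk⇔
    (λ lu → let ¬i = to (leafPath-[] (λ _ → refl)) lu in
            inj₁ (from (leafPath-[] eA) ¬i , [] , from (leafPath-[] eB) ¬i , [] , refl))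
    λ where
      (inj₁ (la , _)) → from (leafPath-[] (λ _ → refl)) (to (leafPath-[] eA) la)
      (inj₂ (lb , _)) → from (leafPath-[] (λ _ → refl)) (to (leafPath-[] eB) lb)
  pathUnion (i ∷ p) =
    ⇔-trans (leafPath-∷ refl)
      (⇔-trans (proj₂ (proj₂ (merged i)) p) (LeafBelow-∷ (eA i) (eB i) ⊎-⇔ LeafBelow-∷ (eB i) (eA i)))

LeafBelow⇔ : LeafBelow A B (reverse u) ⇔ (u ∈ctx A × Covers B u)
LeafBelow⇔ = mk⇔ (λ (la , q , lb , q⊑u) → la , reverse q , leafPath⇒∈ctx lb , ⊑-reverse⇒≺ q⊑u)
                 (λ (la , c , hc , c≺u) → la , reverse c , hc , ≺⇒reverse-⊑ c≺u)

IsUnion-exists : Complete A → Complete B → ∃ λ U → Complete U × IsUnion A B U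
IsUnion-exists cA cB =
  let U , cU , pu = PathUnion-exists cA cB
  in U , cU , λ u → ⇔-trans (pu (reverse u)) (LeafBelow⇔ ⊎-⇔ LeafBelow⇔)

UnionOf-exists : All Complete (S ∷ Ss) → ∃ λ U → Complete U × UnionOf (S ∷ Ss) U
UnionOf-exists {Ss = []}    (cS ∷ []) = _ , cS , single _
UnionOf-exists {Ss = _ ∷ _} (cS ∷ cs) =
  let V , cV , uV = UnionOf-exists cs
      U , cU , iu = IsUnion-exists cS cV
  in U , cU , cons uV iu

AnyContext : List (Tree n) → Str n → Set
AnyContext Ss u = Any (u ∈ctx_) Ss

AllCover : List (Tree n) → Str n → Set
AllCover Ss u = All (λ S → Covers S u) Ss

AllCover-≺ : AllCover Ss a → a ≺ b → AllCover Ss b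
AllCover-≺ cov a≺b = All.map (λ (c , hc , c≺a) → c , hc , ≺-trans c≺a a≺b) cov

-- The longest of the covering contexts is itself covered by every tree.
longest-cover : AllCover (S ∷ Ss) u → ∃ λ m → m ≺ u × AnyContext (S ∷ Ss) m × AllCover (S ∷ Ss) m
longest-cover {Ss = []} ((c , hc , c≺u) ∷ []) = c , c≺u , here hc , (c , hc , ≺-refl c) ∷ []
longest-cover {Ss = _ ∷ _} ((c , hc , c≺u) ∷ cov) with longest-cover cov
... | m , m≺u , any , covm with ≺-comparable c≺u m≺u
...   | inj₁ c≺m = m , m≺u , there any , (c , hc , c≺m) ∷ covm
...   | inj₂ m≺c = c , c≺u , here hc , (c , hc , ≺-refl c) ∷ AllCover-≺ covm m≺c

AllCover-maximal : AllCover Ss u → S ∈ Ss → (x ++ u) ∈ctx S → x ≡ []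
AllCover-maximal {u = u} {x = x} cov m h with All.lookup cov m
... | c , hc , c≺u = x++a≺a⇒x≡[] x (subst (_≺ u) (∈ctx-≺⇒≡ hc h (≺-trans c≺u (x , refl))) c≺u)

mutual
  ∈ctx-UnionOf⁺ : UnionOf Ss U → AnyContext Ss u → AllCover Ss u → u ∈ctx U
  ∈ctx-UnionOf⁺ (single _)   (here h)  _          = h
  ∈ctx-UnionOf⁺ (cons uV iu) (here h)  (_ ∷ cov)  = from (iu _) (inj₁ (h , UnionOf-covers uV cov))
  ∈ctx-UnionOf⁺ (cons uV iu) (there a) (cS ∷ cov) = from (iu _) (inj₂ (∈ctx-UnionOf⁺ uV a cov , cS))

  UnionOf-covers : UnionOf Ss U → AllCover Ss u → Covers U u
  UnionOf-covers {Ss = _ ∷ _} uV cov with longest-cover cov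
  ... | m , m≺u , any , covm = m , ∈ctx-UnionOf⁺ uV any covm , m≺u

∈ctx-UnionOf⁻ : UnionOf Ss U → ∀ u → u ∈ctx U → AnyContext Ss u × AllCover Ss u
∈ctx-UnionOf⁻ (single _) u h = here h , (_ , h , ≺-refl _) ∷ []
∈ctx-UnionOf⁻ (cons uV iu) u h with to (iu u) h
... | inj₁ (hS , c , hV , c≺u) = here hS , (_ , hS , ≺-refl _) ∷ AllCover-≺ (proj₂ (∈ctx-UnionOf⁻ uV _ hV)) c≺u
... | inj₂ (hV , cS) = let any , cov = ∈ctx-UnionOf⁻ uV u hV in there any , cS ∷ cov

AllCover-subtrees-infix : AllCover (subtrees T) u → S ∈ subtrees T → ∀ x y → (x ++ u ++ y) ∈ctx S → x ≡ []
AllCover-subtrees-infix {u = u} cov m x y h =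
  let s , hs = ∈ctx-subtree⁻ m (x ++ u ++ y) h
      _ , m′ , h′ = ∈ctx-subtree⁺ (x ++ u) (y ++ s) (subst (_∈ctx _) (regroup s) hs)
  in AllCover-maximal cov m′ h′
  where
  regroup : ∀ s → (x ++ u ++ y) ++ s ≡ (x ++ u) ++ y ++ s
  regroup s = begin
    (x ++ u ++ y) ++ s     ≡⟨ ++-assoc x (u ++ y) s ⟩
    x ++ (u ++ y) ++ s     ≡⟨ cong (x ++_) (++-assoc u y s) ⟩
    x ++ u ++ y ++ s       ≡⟨ ++-assoc x u (y ++ s) ⟨
    (x ++ u) ++ y ++ s     ∎
    where open ≡-Reasoning

extend-to-AllCover : All Complete Ss → ∀ v₀ → ∃ λ v → v₀ ≺ v × (v ≡ v₀ ⊎ AnyContext Ss v) × AllCover Ss v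
extend-to-AllCover []        v₀ = v₀ , ≺-refl v₀ , inj₁ refl , []
extend-to-AllCover (cS ∷ cs) v₀ with extend-to-AllCover cs v₀
... | v , v₀≺v , v-new , cov with ∈ctx-dichotomy cS v
...   | inj₁ cS-v = v , v₀≺v , map₂ there v-new , cS-v ∷ cov
...   | inj₂ (c , hc , v≺c) = c , ≺-trans v₀≺v v≺c , inj₂ (here hc) , (c , hc , ≺-refl c) ∷ AllCover-≺ cov v≺c

PerfectMemory-covers : PerfectMemory P → c ∈ctx P → ∀ w → Covers P (c ++ w)
PerfectMemory-covers {c = c} pm hc [] = c , hc , [] , ++-identityʳ c
PerfectMemory-covers {c = c} pm hc (j ∷ w) with pm c hc j
... | ℓ₁ , h₁ , ℓ₁≺cj with PerfectMemory-covers pm h₁ w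
...   | ℓ , h , ℓ≺ℓ₁w = ℓ , h , ≺-trans ℓ≺ℓ₁w (subst ((ℓ₁ ++ w) ≺_) (++-assoc c [ j ] w) (≺-++ʳ w ℓ₁≺cj))

-- Reading u from b gives a context ℓ comparable with u; if ℓ were a proper
-- postfix of u, reading s from ℓ would land back on b, which forces u ≺ ℓ anyway.
PerfectMemory-infix : PerfectMemory P → b ∈ctx P → (u ++ s) ≺ b → ∃ λ ℓ → ℓ ∈ctx P × u ≺ ℓ
PerfectMemory-infix {b = b} {u = u} {s = s} pm hb us≺b with PerfectMemory-covers pm hb u
... | ℓ , hℓ , ℓ≺bu with ≺-comparable ℓ≺bu (b , refl)
...   | inj₂ u≺ℓ = ℓ , hℓ , u≺ℓ
...   | inj₁ ℓ≺u =
  let ℓ′ , hℓ′ , ℓ′≺ℓs = PerfectMemory-covers pm hℓ s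
      ℓ′≡b = ∈ctx-≺⇒≡ hℓ′ hb (≺-trans ℓ′≺ℓs (≺-trans (≺-++ʳ s ℓ≺u) us≺b))
  in ℓ , hℓ , ≺-cancelʳ s (≺-trans us≺b (subst (_≺ (ℓ ++ s)) ℓ′≡b ℓ′≺ℓs))

module _ {n} {T U : Tree n} (cT : Complete T) (uF : UnionOf (subtrees T) U) where

  UnionOf-contains : T ⊆ʳ U
  UnionOf-contains t ht with extend-to-AllCover (subtrees-complete cT) t
  ... | v , t≺v , inj₁ refl , cov = v , ∈ctx-UnionOf⁺ uF (lose (∈-subtrees⁺ root) ht) cov , t≺v
  ... | v , t≺v , inj₂ any  , cov = v , ∈ctx-UnionOf⁺ uF any cov , t≺v

  UnionOf-perfectMemory : PerfectMemory U
  UnionOf-perfectMemory u hu i = UnionOf-covers uF (All.tabulate covers-ui)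
    where
    covers-ui : S ∈ subtrees T → Covers S (u ++ [ i ])
    covers-ui m with ∈ctx-dichotomy (All.lookup (subtrees-complete cT) m) (u ++ [ i ])
    ... | inj₁ cov = cov
    ... | inj₂ (_ , hc , z , refl) with AllCover-subtrees-infix (proj₂ (∈ctx-UnionOf⁻ uF u hu)) m z [ i ] hc
    ...   | refl = _ , hc , ≺-refl _

  UnionOf-minimal : (P : Tree n) → PerfectMemory P → T ⊆ʳ P → U ⊆ʳ P
  UnionOf-minimal P pm T⊆P u hu =
    let _ , m , huS  = find (proj₁ (∈ctx-UnionOf⁻ uF u hu))
        s , hus      = ∈ctx-subtree⁻ m u huS
        b , hb , us≺b = T⊆P (u ++ s) hus
    in PerfectMemory-infix pm hb us≺b

subtrees-UnionOf : Complete T → ∃ (UnionOf (subtrees T))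
subtrees-UnionOf {T = node _} cT = let U , _ , uF = UnionOf-exists (subtrees-complete cT) in U , uF

corollary3 : {n : ℕ} (T : Tree n) → Complete T →
    (∃ λ U → UnionOf (subtrees T) U) ×
    ((U : Tree n) → UnionOf (subtrees T) U → IsClosure T U)
corollary3 T cT = subtrees-UnionOf cT , λ U uF →
  UnionOf-perfectMemory cT uF , UnionOf-contains cT uF , UnionOf-minimal cT uF
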